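{- Let $S$ be a finite set, let $S_1,\dots,S_n\subseteq S$, and let $k\ge 2$ be an integer. For a partition of $\{S_1,\dots,S_n\}$ into $k$ (possibly empty) covers $c_1,\dots,c_k$, define its coverage as $\sum_{i=1}^k \left|\bigcup_{S_j\in c_i} S_j\right|$, and let $\mathrm{OPT}$ be the maximum coverage over all such partitions. Consider the randomized algorithm that assigns each subset $S_j$ independently to a cover $c_i$ with $i$ chosen uniformly at random from $\{1,\dots,k\}$. Then the expected coverage of the resulting partition is at least $\left(1-\frac{1}{e}\right)\mathrm{OPT}$.
   Context: This is the SET K-COVER problem: given $S$, the collection $\{S_j\}_{j=1}^n$ and $k$, find a partition of the subsets into $k$ covers maximizing the coverage $\sum_{i=1}^k |\bigcup_{S_j\in c_i} S_j|$, i.e., the total over elements $v\in S$ of the number of covers containing a subset that contains $v$. -}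

module Defs where

open import Data.Nat as ℕ using (ℕ; zero; suc; _^_; _!; _⊔_)
open import Data.Fin using (Fin)
open import Data.Fin.Properties using (_≟_)
open import Data.Fin.Subset using (Subset; ⋃; ∣_∣)
open import Data.List using (List; []; _∷_; map; filter; concatMap; allFin; foldr; upTo)
open import Data.Nat.ListAction using (sum)
open import Data.Vec using (Vec; lookup)
import Data.Vec as Vec
open import Data.Integer using (+_)
open import Data.Rational using (ℚ; _/_; 0ℚ; _+_)

-- A partition of {S_1,…,S_n} into k (possibly empty, labelled) covers c_1..c_k
-- is an assignment a : Vec (Fin k) n, subset S_j going to cover c_(a_j).

coverUnion : ∀ {m n k} → (Fin n → Subset m) → Vec (Fin k) n → Fin k → Subset m
coverUnion {n = n} S a i = ⋃ (map S (filter (λ j → lookup a j ≟ i) (allFin n)))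

coverage : ∀ {m n k} → (Fin n → Subset m) → Vec (Fin k) n → ℕ
coverage {k = k} S a = sum (map (λ i → ∣ coverUnion S a i ∣) (allFin k))

allAssignments : (n k : ℕ) → List (Vec (Fin k) n)
allAssignments zero    k = Vec.[] ∷ []
allAssignments (suc n) k =
  concatMap (λ i → map (λ v → i Vec.∷ v) (allAssignments n k)) (allFin k)

OPT : ∀ {m n} → (k : ℕ) → (Fin n → Subset m) → ℕ
OPT {n = n} k S = foldr _⊔_ 0 (map (coverage S) (allAssignments n k))

-- a / d as a rational (d = 0 sent to 0; never relevant since k ≥ 2 and j! ≥ 1).
_/ℕ_ : ℕ → ℕ → ℚ
a /ℕ zero  = 0ℚ
a /ℕ suc d = (+ a) / suc d

-- Expected coverage of the uniform independent random assignment: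
-- each of the k^n assignments has probability 1/k^n.
expectedCoverage : ∀ {m n} → (k : ℕ) → (Fin n → Subset m) → ℚ
expectedCoverage {n = n} k S =
  sum (map (coverage S) (allAssignments n k)) /ℕ (k ^ n)

-- Partial sums of e = Σ_{j≥0} 1/j!:  eApprox N = Σ_{j=0}^{N} 1/j!.
eApprox : ℕ → ℚ
eApprox N = foldr (λ j acc → (1 /ℕ (j !)) + acc) 0ℚ (upTo (suc N))

module Submission where

-- Coverage is a sum over the elements of S. Write q = 1 − 1/k (in the code k = suc p and q = p/k)
-- and let an element lie in D of the subsets. Under the random assignment a fixed cover misses the
-- element with probability q^D, so on average the element lies in k(1 − q^D) covers; by concavity
-- of D ↦ 1 − q^D this is at least min(k, D)·(1 − q^k), while in any partition the element lies in
-- at most min(k, D) covers. Hence the expected coverage is at least (1 − q^k)·OPT, and q^k ≤ 1/e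
-- because e^(1/k) ≤ 1/q, an inequality that survives truncating the exponential series.

open import Defs

import Algebra.Properties.CommutativeSemigroup as CommutativeSemigroupProperties
open import Data.Bool.Base using (Bool; true; false; _∧_; _∨_; not; if_then_else_)
open import Data.Bool.ListAction using (any; or)
open import Data.Bool.Properties using (∧-identityʳ; ∧-zeroʳ)
open import Data.Fin.Base using (Fin; zero; suc)
open import Data.Fin.Properties using (_≟_)
open import Data.Fin.Subset using (Subset; ⋃; ∣_∣)
open import Data.List.Base
  using (List; []; _∷_; map; filter; concatMap; allFin; tabulate; foldr; upTo; _++_; _∷ʳ_)
open import Data.List.Properties using (map-tabulate; map-∘; map-++; foldr-∷ʳ; upTo-∷ʳ)
open import Data.Nat.Base as ℕ
  using (ℕ; zero; suc; _^_; _≤_; _<_; _≤′_; ≤′-refl; ≤′-step; _⊓_; _⊔_; z≤n; s≤s; NonZero; >-nonZero; _!)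
open import Data.Nat.ListAction using (sum)
open import Data.Nat.ListAction.Properties using (sum-++)
open import Data.Nat.Properties hiding (_≟_)
open import Data.Nat.Tactic.RingSolver using (solve-∀)
open import Data.Sum.Base using (inj₁; inj₂)
open import Data.Vec.Base using (Vec; []; _∷_; head; tail; lookup)
open import Function.Base using (_∘_)
open import Relation.Binary.PropositionalEquality
open import Relation.Nullary.Decidable.Core using (does)
open import Relation.Unary using (Decidable)

open import Algebra.Properties.Semiring.Sum +-*-semiring
  using (sum-syntax; sum-cong-≗; sum-replicate-zero; ∑-distrib-+; ∑-comm; *-distribʳ-sum)
module +-Comm = CommutativeSemigroupProperties +-commutativeSemigroup
module *-Comm = CommutativeSemigroupProperties *-commutativeSemigroup

module FiniteSums where

  open import Data.Nat.Base using (_+_; _*_)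

  𝕀 : Bool → ℕ
  𝕀 true  = 1
  𝕀 false = 0

  𝕀≤1 : ∀ b → 𝕀 b ≤ 1
  𝕀≤1 true  = ≤-refl
  𝕀≤1 false = z≤n

  𝕀+𝕀-not : ∀ b → 𝕀 b + 𝕀 (not b) ≡ 1
  𝕀+𝕀-not true  = refl
  𝕀+𝕀-not false = refl

  𝕀-∨-≤ : ∀ a b → 𝕀 (a ∨ b) ≤ 𝕀 a + 𝕀 b
  𝕀-∨-≤ true  b = s≤s z≤n
  𝕀-∨-≤ false b = ≤-refl

  𝕀-not-∨ : ∀ a b → 𝕀 (not (a ∨ b)) ≡ 𝕀 (not a) * 𝕀 (not b)
  𝕀-not-∨ true  b = refl
  𝕀-not-∨ false b = sym (+-identityʳ _)

  ∑-const : ∀ n c → ∑[ i < n ] c ≡ n * c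
  ∑-const zero    c = refl
  ∑-const (suc n) c = cong (c +_) (∑-const n c)

  ∑-mono-≤ : ∀ {n} {f g : Fin n → ℕ} → (∀ i → f i ≤ g i) → ∑[ i < n ] f i ≤ ∑[ i < n ] g i
  ∑-mono-≤ {zero}  f≤g = z≤n
  ∑-mono-≤ {suc n} f≤g = +-mono-≤ (f≤g zero) (∑-mono-≤ (f≤g ∘ suc))

  ∑-𝕀-≟ˡ : ∀ {k} (i : Fin k) → ∑[ x < k ] 𝕀 (does (x ≟ i)) ≡ 1
  ∑-𝕀-≟ˡ {suc k} zero    = cong suc (sum-replicate-zero k)
  ∑-𝕀-≟ˡ {suc k} (suc i) = ∑-𝕀-≟ˡ i

  ∑-𝕀-≟ʳ : ∀ {k} (x : Fin k) → ∑[ i < k ] 𝕀 (does (x ≟ i)) ≡ 1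
  ∑-𝕀-≟ʳ {suc k} zero    = cong suc (sum-replicate-zero k)
  ∑-𝕀-≟ʳ {suc k} (suc x) = ∑-𝕀-≟ʳ x

  sum-tabulate : ∀ {n} (f : Fin n → ℕ) → sum (tabulate f) ≡ ∑[ i < n ] f i
  sum-tabulate {zero}  f = refl
  sum-tabulate {suc n} f = cong (f zero +_) (sum-tabulate (f ∘ suc))

  sum-map-allFin : ∀ {n} (f : Fin n → ℕ) → sum (map f (allFin n)) ≡ ∑[ i < n ] f i
  sum-map-allFin f = trans (cong sum (map-tabulate (λ i → i) f)) (sum-tabulate f)

  module _ {A : Set} where

    sum-map-cong : ∀ {f g : A → ℕ} → (∀ x → f x ≡ g x) → ∀ xs → sum (map f xs) ≡ sum (map g xs)
    sum-map-cong f≡g []       = refl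
    sum-map-cong f≡g (x ∷ xs) = cong₂ _+_ (f≡g x) (sum-map-cong f≡g xs)

    sum-map-+ : ∀ (f g : A → ℕ) xs → sum (map (λ x → f x + g x) xs) ≡ sum (map f xs) + sum (map g xs)
    sum-map-+ f g []       = refl
    sum-map-+ f g (x ∷ xs) =
      trans (cong (f x + g x +_) (sum-map-+ f g xs)) (+-Comm.interchange (f x) (g x) _ _)

    sum-map-*ˡ : ∀ c (f : A → ℕ) xs → sum (map (λ x → c * f x) xs) ≡ c * sum (map f xs)
    sum-map-*ˡ c f []       = sym (*-zeroʳ c)
    sum-map-*ˡ c f (x ∷ xs) =
      trans (cong (c * f x +_) (sum-map-*ˡ c f xs)) (sym (*-distribˡ-+ c (f x) _))

    sum-map-∑ : ∀ {r} (f : Fin r → A → ℕ) xs →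
                sum (map (λ x → ∑[ i < r ] f i x) xs) ≡ ∑[ i < r ] sum (map (f i) xs)
    sum-map-∑ {r} f []       = sym (sum-replicate-zero r)
    sum-map-∑ {r} f (x ∷ xs) = trans (cong (∑[ i < r ] f i x +_) (sum-map-∑ f xs))
                                     (sym (∑-distrib-+ (λ i → f i x) (λ i → sum (map (f i) xs))))

    sum-map-concatMap : ∀ {B : Set} (f : B → ℕ) (g : A → List B) xs →
                        sum (map f (concatMap g xs)) ≡ sum (map (λ x → sum (map f (g x))) xs)
    sum-map-concatMap f g []       = refl
    sum-map-concatMap f g (x ∷ xs) = begin
      sum (map f (g x ++ concatMap g xs))               ≡⟨ cong sum (map-++ f (g x) _) ⟩
      sum (map f (g x) ++ map f (concatMap g xs))       ≡⟨ sum-++ (map f (g x)) _ ⟩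
      sum (map f (g x)) + sum (map f (concatMap g xs))  ≡⟨ cong (_ +_) (sum-map-concatMap f g xs) ⟩
      sum (map (λ x → sum (map f (g x))) (x ∷ xs))      ∎
      where open ≡-Reasoning

    foldr-⊔-lub : ∀ (f : A → ℕ) {c} xs → (∀ x → f x ≤ c) → foldr _⊔_ 0 (map f xs) ≤ c
    foldr-⊔-lub f []       f≤c = z≤n
    foldr-⊔-lub f (x ∷ xs) f≤c = ⊔-lub (f≤c x) (foldr-⊔-lub f xs f≤c)

open FiniteSums

module Inequalities where

  open import Data.Nat.Base using (_+_; _*_)

  ratio-antitone : ∀ (x y : ℕ → ℕ) → (∀ j → NonZero (y j)) →
                   (∀ j → x j * y (suc j) ≤ x (suc j) * y j) →
                   ∀ {i j} → i ≤ j → x i * y j ≤ x j * y i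
  ratio-antitone x y y≢0 step i≤j = go (≤⇒≤′ i≤j)
    where
    go : ∀ {i j} → i ≤′ j → x i * y j ≤ x j * y i
    go ≤′-refl = ≤-refl
    go {i} (≤′-step {j} i≤j) = *-cancelˡ-≤ (y j) {{y≢0 j}} (begin
      y j * (x i * y (suc j))   ≡⟨ *-Comm.x∙yz≈z∙yx (y j) (x i) (y (suc j)) ⟩
      y (suc j) * (x i * y j)   ≤⟨ *-monoʳ-≤ (y (suc j)) (go i≤j) ⟩
      y (suc j) * (x j * y i)   ≡⟨ *-Comm.x∙yz≈z∙yx (y (suc j)) (x j) (y i) ⟩
      y i * (x j * y (suc j))   ≤⟨ *-monoʳ-≤ (y i) (step j) ⟩
      y i * (x (suc j) * y j)   ≡⟨ *-Comm.x∙yz≈z∙yx (y i) (x (suc j)) (y j) ⟩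
      y j * (x (suc j) * y i)   ∎)
      where open ≤-Reasoning

  module _ (p : ℕ) where

    gap : ℕ → ℕ
    gap zero    = 0
    gap (suc j) = p ^ j + suc p * gap j

    ^≡^+gap : ∀ j → suc p ^ j ≡ p ^ j + gap j
    ^≡^+gap zero    = refl
    ^≡^+gap (suc j) = begin
      suc p * suc p ^ j                     ≡⟨ cong (suc p *_) (^≡^+gap j) ⟩
      suc p * (p ^ j + gap j)               ≡⟨ *-distribˡ-+ (suc p) (p ^ j) (gap j) ⟩
      p ^ j + p * p ^ j + suc p * gap j     ≡⟨ +-Comm.xy∙z≈y∙xz (p ^ j) (p * p ^ j) (suc p * gap j) ⟩
      p * p ^ j + (p ^ j + suc p * gap j)   ∎
      where open ≡-Reasoning

    0<gap[1+j] : ∀ j → 0 < gap (suc j)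
    0<gap[1+j] zero    = s≤s z≤n
    0<gap[1+j] (suc j) =
      ≤-trans (0<gap[1+j] j) (≤-trans (m≤n*m (gap (suc j)) (suc p)) (m≤n+m _ (p ^ suc j)))

    j*p^j≤[1+p]*gap : ∀ j → j * p ^ j ≤ suc p * gap j
    j*p^j≤[1+p]*gap zero    = z≤n
    j*p^j≤[1+p]*gap (suc j) = begin
      p * p ^ j + j * (p * p ^ j)              ≡⟨ cong (p * p ^ j +_) (*-Comm.x∙yz≈y∙xz j p (p ^ j)) ⟩
      p * p ^ j + p * (j * p ^ j)              ≤⟨ +-mono-≤ (*-monoˡ-≤ (p ^ j) (n≤1+n p))
                                                           (*-mono-≤ (n≤1+n p) (j*p^j≤[1+p]*gap j)) ⟩
      suc p * p ^ j + suc p * (suc p * gap j)  ≡⟨ *-distribˡ-+ (suc p) (p ^ j) _ ⟨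
      suc p * (p ^ j + suc p * gap j)          ∎
      where open ≤-Reasoning

    gap-ratio-step : ∀ j → j * suc p ^ j * gap (suc j) ≤ suc j * suc p ^ suc j * gap j
    gap-ratio-step j = begin
      j * suc p ^ j * gap (suc j)                     ≡⟨ *-Comm.xy∙z≈y∙xz j (suc p ^ j) (gap (suc j)) ⟩
      suc p ^ j * (j * (p ^ j + suc p * gap j))       ≡⟨ cong (suc p ^ j *_) (*-distribˡ-+ j (p ^ j) _) ⟩
      suc p ^ j * (j * p ^ j + j * (suc p * gap j))   ≤⟨ *-monoʳ-≤ (suc p ^ j) (+-monoˡ-≤ _ (j*p^j≤[1+p]*gap j)) ⟩
      suc p ^ j * (suc j * (suc p * gap j))           ≡⟨ regroup j (suc p) (suc p ^ j) (gap j) ⟩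
      suc j * suc p ^ suc j * gap j                   ∎
      where
      open ≤-Reasoning
      regroup : ∀ j k K g → K * (suc j * (k * g)) ≡ suc j * (k * K) * g
      regroup = solve-∀

    gap-concave : ∀ {i j} → i ≤ j → i * suc p ^ i * gap j ≤ j * suc p ^ j * gap i
    gap-concave {zero}          _         = z≤n
    gap-concave {suc i} {suc j} (s≤s i≤j) =
      ratio-antitone (λ l → suc l * suc p ^ suc l) (gap ∘ suc)
                     (>-nonZero ∘ 0<gap[1+j]) (gap-ratio-step ∘ suc) i≤j

    gap/^-mono : ∀ {i j} → i ≤ j → gap i * suc p ^ j ≤ gap j * suc p ^ i
    gap/^-mono = ratio-antitone gap (suc p ^_) (λ j → m^n≢0 (suc p) j) step
      where
      step : ∀ j → gap j * suc p ^ suc j ≤ gap (suc j) * suc p ^ j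
      step j = begin
        gap j * (suc p * suc p ^ j)   ≡⟨ *-Comm.x∙yz≈yx∙z (gap j) (suc p) (suc p ^ j) ⟩
        suc p * gap j * suc p ^ j     ≤⟨ *-monoˡ-≤ (suc p ^ j) (m≤n+m _ (p ^ j)) ⟩
        gap (suc j) * suc p ^ j       ∎
        where open ≤-Reasoning

    -- min(k, D)·(1 − q^k) ≤ k·(1 − q^D) for k = suc p and q = p/k, multiplied through by k^D·k^k.
    ⊓-gap : ∀ D → (suc p ⊓ D) * suc p ^ D * gap (suc p) ≤ suc p * suc p ^ suc p * gap D
    ⊓-gap D with ≤-total D (suc p)
    ... | inj₁ D≤k rewrite m≥n⇒m⊓n≡n D≤k = gap-concave D≤k
    ... | inj₂ k≤D rewrite m≤n⇒m⊓n≡m k≤D = begin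
      suc p * suc p ^ D * gap (suc p)     ≡⟨ *-Comm.xy∙z≈x∙zy (suc p) (suc p ^ D) _ ⟩
      suc p * (gap (suc p) * suc p ^ D)   ≤⟨ *-monoʳ-≤ (suc p) (gap/^-mono k≤D) ⟩
      suc p * (gap D * suc p ^ suc p)     ≡⟨ *-Comm.xy∙z≈x∙zy (suc p) (suc p ^ suc p) _ ⟨
      suc p * suc p ^ suc p * gap D       ∎
      where open ≤-Reasoning

  [1+m]^[1+j]≤m^[1+j]+[1+j]*[1+m]^j : ∀ m j → suc m ^ suc j ≤ m ^ suc j + suc j * suc m ^ j
  [1+m]^[1+j]≤m^[1+j]+[1+j]*[1+m]^j m zero    = ≤-reflexive (+-comm 1 (m * 1))
  [1+m]^[1+j]≤m^[1+j]+[1+j]*[1+m]^j m (suc j) = begin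
    suc m * suc m ^ suc j
      ≤⟨ *-monoʳ-≤ (suc m) ([1+m]^[1+j]≤m^[1+j]+[1+j]*[1+m]^j m j) ⟩
    suc m * (m ^ suc j + suc j * suc m ^ j)
      ≡⟨ expand m (m ^ suc j) j (suc m ^ j) ⟩
    m * m ^ suc j + (m ^ suc j + suc j * suc m ^ suc j)
      ≤⟨ +-monoʳ-≤ (m * m ^ suc j) (+-monoˡ-≤ _ (^-monoˡ-≤ (suc j) (n≤1+n m))) ⟩
    m * m ^ suc j + (suc m ^ suc j + suc j * suc m ^ suc j)
      ∎
    where
    open ≤-Reasoning
    expand : ∀ m a j b → suc m * (a + suc j * b) ≡ m * a + (a + suc j * (suc m * b))
    expand = solve-∀

  eNumerator : ℕ → ℕ
  eNumerator zero    = 1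
  eNumerator (suc N) = suc N * eNumerator N + 1

  module _ (p : ℕ) where

    -- scaledExp m N = N!·k^N·∑_{j ≤ N} (m/k)^j / j!, the truncated exponential at m/k (k = suc p).
    scaledExp : ℕ → ℕ → ℕ
    scaledExp m zero    = 1
    scaledExp m (suc N) = suc N * suc p * scaledExp m N + m ^ suc N

    scaledExp-zero : ∀ N → scaledExp 0 N ≡ N ! * suc p ^ N
    scaledExp-zero zero    = refl
    scaledExp-zero (suc N) rewrite scaledExp-zero N = regroup (suc N) (suc p) (N !) (suc p ^ N)
      where
      regroup : ∀ n k f K → n * k * (f * K) + 0 ≡ n * f * (k * K)
      regroup = solve-∀

    scaledExp-one : ∀ N → scaledExp (suc p) N ≡ suc p ^ N * eNumerator N
    scaledExp-one zero    = refl
    scaledExp-one (suc N) rewrite scaledExp-one N = regroup (suc N) (suc p) (suc p ^ N) (eNumerator N)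
      where
      regroup : ∀ n k K w → n * k * (K * w) + k * K ≡ k * K * (n * w + 1)
      regroup = solve-∀

    -- e_{N+1}(x + 1/k) ≤ e_{N+1}(x) + e_N(x + 1/k)/k for the truncated exponential e_N, as e_N is the
    -- derivative of e_{N+1} and is increasing.
    scaledExp-step : ∀ m N → scaledExp (suc m) (suc N) ≤ scaledExp m (suc N) + suc N * scaledExp (suc m) N
    scaledExp-step m zero    = ≤-reflexive (regroup (suc p) m)
      where
      regroup : ∀ k m → 1 * k * 1 + suc m * 1 ≡ 1 * k * 1 + m * 1 + 1 * 1
      regroup = solve-∀
    scaledExp-step m (suc N) = begin
      suc n * k * scaledExp (suc m) n + suc m ^ suc n
        ≤⟨ +-mono-≤ (*-monoʳ-≤ (suc n * k) (scaledExp-step m N)) ([1+m]^[1+j]≤m^[1+j]+[1+j]*[1+m]^j m n) ⟩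
      suc n * k * (scaledExp m n + n * scaledExp (suc m) N) + (m ^ suc n + suc n * suc m ^ n)
        ≡⟨ regroup n k (scaledExp m n) (scaledExp (suc m) N) (m ^ suc n) (suc m ^ n) ⟩
      (suc n * k * scaledExp m n + m ^ suc n) + suc n * (n * k * scaledExp (suc m) N + suc m ^ n)
        ∎
      where
      open ≤-Reasoning
      n = suc N
      k = suc p
      regroup : ∀ n k a b c d →
                suc n * k * (a + n * b) + (c + suc n * d) ≡ (suc n * k * a + c) + suc n * (n * k * b + d)
      regroup = solve-∀

    -- ∑_{j ≤ N} (m/k)^j / j! ≤ (k/p)^m, the truncated form of e^(1/k) ≤ k/p.
    scaledExp-bound : ∀ m N → p ^ m * scaledExp m N ≤ N ! * suc p ^ (m + N)
    scaledExp-bound zero    N       = ≤-reflexive (trans (+-identityʳ _) (scaledExp-zero N))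
    scaledExp-bound (suc m) zero    = begin
      p ^ suc m * 1            ≡⟨ *-identityʳ _ ⟩
      p ^ suc m                ≤⟨ ^-monoˡ-≤ (suc m) (n≤1+n p) ⟩
      suc p ^ suc m            ≡⟨ trans (*-identityˡ _) (cong (suc p ^_) (+-identityʳ (suc m))) ⟨
      1 * suc p ^ (suc m + 0)  ∎
      where open ≤-Reasoning
    scaledExp-bound (suc m) (suc N) = begin
      p * p ^ m * scaledExp (suc m) (suc N)
        ≤⟨ *-monoʳ-≤ (p * p ^ m) (scaledExp-step m N) ⟩
      p * p ^ m * (scaledExp m (suc N) + suc N * scaledExp (suc m) N)
        ≡⟨ distribute p (p ^ m) (suc N) (scaledExp m (suc N)) (scaledExp (suc m) N) ⟩
      p * (p ^ m * scaledExp m (suc N)) + suc N * (p ^ suc m * scaledExp (suc m) N)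
        ≤⟨ +-mono-≤ (*-monoʳ-≤ p (scaledExp-bound m (suc N))) (*-monoʳ-≤ (suc N) (scaledExp-bound (suc m) N)) ⟩
      p * (suc N ! * K) + suc N * (N ! * suc p ^ (suc m + N))
        ≡⟨ cong (λ e → p * (suc N ! * K) + suc N * (N ! * suc p ^ e)) (+-suc m N) ⟨
      p * (suc N * N ! * K) + suc N * (N ! * K)
        ≡⟨ collect p (suc N) (N !) K ⟩
      suc N ! * (suc p * K)
        ∎
      where
      open ≤-Reasoning
      K = suc p ^ (m + suc N)
      distribute : ∀ p P n a b → p * P * (a + n * b) ≡ p * (P * a) + n * (p * P * b)
      distribute = solve-∀
      collect : ∀ p n f K → p * (n * f * K) + n * (f * K) ≡ n * f * (suc p * K)
      collect = solve-∀

    eNumerator-bound : ∀ N → p ^ suc p * eNumerator N ≤ suc p ^ suc p * N !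
    eNumerator-bound N = *-cancelˡ-≤ (suc p ^ N) {{m^n≢0 (suc p) N}} (begin
      suc p ^ N * (p ^ suc p * eNumerator N)   ≡⟨ *-Comm.x∙yz≈y∙xz (suc p ^ N) (p ^ suc p) (eNumerator N) ⟩
      p ^ suc p * (suc p ^ N * eNumerator N)   ≡⟨ cong (p ^ suc p *_) (scaledExp-one N) ⟨
      p ^ suc p * scaledExp (suc p) N          ≤⟨ scaledExp-bound (suc p) N ⟩
      N ! * suc p ^ (suc p + N)                ≡⟨ cong (N ! *_) (^-distribˡ-+-* (suc p) (suc p) N) ⟩
      N ! * (suc p ^ suc p * suc p ^ N)        ≡⟨ *-Comm.x∙yz≈z∙yx (N !) (suc p ^ suc p) (suc p ^ N) ⟩
      suc p ^ N * (suc p ^ suc p * N !)        ∎)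
      where open ≤-Reasoning

open Inequalities

module Coverage where

  open import Data.Nat.Base using (_+_; _*_)

  assignmentSum : ∀ n k → (Vec (Fin k) n → ℕ) → ℕ
  assignmentSum n k f = sum (map f (allAssignments n k))

  assignmentSum-∷ : ∀ n k (f : Vec (Fin k) (suc n) → ℕ) →
                    assignmentSum (suc n) k f ≡ ∑[ x < k ] assignmentSum n k (λ a → f (x ∷ a))
  assignmentSum-∷ n k f = begin
    sum (map f (concatMap (λ x → map (x ∷_) (allAssignments n k)) (allFin k)))
      ≡⟨ sum-map-concatMap f _ (allFin k) ⟩
    sum (map (λ x → sum (map f (map (x ∷_) (allAssignments n k)))) (allFin k))
      ≡⟨ sum-map-cong (λ x → cong sum (sym (map-∘ (allAssignments n k)))) (allFin k) ⟩
    sum (map (λ x → assignmentSum n k (λ a → f (x ∷ a))) (allFin k))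
      ≡⟨ sum-map-allFin (λ x → assignmentSum n k (λ a → f (x ∷ a))) ⟩
    ∑[ x < k ] assignmentSum n k (λ a → f (x ∷ a)) ∎
      where open ≡-Reasoning

  assignmentSum-const : ∀ n k c → assignmentSum n k (λ _ → c) ≡ k ^ n * c
  assignmentSum-const zero    k c = refl
  assignmentSum-const (suc n) k c = begin
    assignmentSum (suc n) k (λ _ → c)     ≡⟨ assignmentSum-∷ n k _ ⟩
    ∑[ x < k ] assignmentSum n k (λ _ → c) ≡⟨ sum-cong-≗ {k} (λ _ → assignmentSum-const n k c) ⟩
    ∑[ x < k ] (k ^ n * c)                ≡⟨ ∑-const k _ ⟩
    k * (k ^ n * c)                       ≡⟨ *-assoc k _ c ⟨
    k ^ suc n * c                          ∎
      where open ≡-Reasoning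

  hits : ∀ {n k} → (Fin n → Bool) → Vec (Fin k) n → Fin k → Bool
  hits b []      i = false
  hits b (x ∷ a) i = (b zero ∧ does (x ≟ i)) ∨ hits (b ∘ suc) a i

  coveredCount : ∀ {n k} → (Fin n → Bool) → Vec (Fin k) n → ℕ
  coveredCount {k = k} b a = ∑[ i < k ] 𝕀 (hits b a i)

  degree : ∀ {n} → (Fin n → Bool) → ℕ
  degree {n} b = ∑[ j < n ] 𝕀 (b j)

  incidence : ∀ {m n} → (Fin n → Subset m) → Fin m → Fin n → Bool
  incidence S zero    = head ∘ S
  incidence S (suc x) = incidence (tail ∘ S) x

  ∣x∷p∣ : ∀ {m} x (p : Subset m) → ∣ x ∷ p ∣ ≡ 𝕀 x + ∣ p ∣
  ∣x∷p∣ true  p = refl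
  ∣x∷p∣ false p = refl

  ∣[]∣ : (p : Subset 0) → ∣ p ∣ ≡ 0
  ∣[]∣ [] = refl

  ⋃-∷ : ∀ {m} (ps : List (Subset (suc m))) → ⋃ ps ≡ any head ps ∷ ⋃ (map tail ps)
  ⋃-∷ []                = refl
  ⋃-∷ ((x ∷ p) ∷ ps) rewrite ⋃-∷ ps = refl

  any-filter : ∀ {A : Set} {P : A → Set} (f : A → Bool) (P? : Decidable P) xs →
               any f (filter P? xs) ≡ any (λ x → f x ∧ does (P? x)) xs
  any-filter f P? []       = refl
  any-filter f P? (x ∷ xs) with does (P? x)
  ... | true  rewrite ∧-identityʳ (f x) = cong (f x ∨_) (any-filter f P? xs)
  ... | false rewrite ∧-zeroʳ (f x)     = any-filter f P? xs

  any-tabulate-suc : ∀ {n} (f : Fin (suc n) → Bool) → any f (tabulate suc) ≡ any (f ∘ suc) (allFin n)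
  any-tabulate-suc f = cong or (trans (map-tabulate suc f) (sym (map-tabulate (λ j → j) (f ∘ suc))))

  any-hits : ∀ {n k} (b : Fin n → Bool) (a : Vec (Fin k) n) i →
             any (λ j → b j ∧ does (lookup a j ≟ i)) (allFin n) ≡ hits b a i
  any-hits b []      i = refl
  any-hits b (x ∷ a) i = cong (b zero ∧ does (x ≟ i) ∨_)
    (trans (any-tabulate-suc (λ j → b j ∧ does (lookup (x ∷ a) j ≟ i))) (any-hits (b ∘ suc) a i))

  coverUnion-∷ : ∀ {m n k} (S : Fin n → Subset (suc m)) (a : Vec (Fin k) n) i →
                 coverUnion S a i ≡ hits (head ∘ S) a i ∷ coverUnion (tail ∘ S) a i
  coverUnion-∷ {n = n} S a i = trans (⋃-∷ (map S js)) (cong₂ _∷_ covered (cong ⋃ (sym (map-∘ js))))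
    where
    js = filter (λ j → lookup a j ≟ i) (allFin n)
    covered : any head (map S js) ≡ hits (head ∘ S) a i
    covered = begin
      any head (map S js)                                          ≡⟨ cong or (map-∘ js) ⟨
      any (head ∘ S) js                                            ≡⟨ any-filter (head ∘ S) _ (allFin n) ⟩
      any (λ j → head (S j) ∧ does (lookup a j ≟ i)) (allFin n)    ≡⟨ any-hits (head ∘ S) a i ⟩
      hits (head ∘ S) a i                                          ∎
      where open ≡-Reasoning

  ∣coverUnion∣≡∑hits : ∀ {m n k} (S : Fin n → Subset m) (a : Vec (Fin k) n) i →
                       ∣ coverUnion S a i ∣ ≡ ∑[ x < m ] 𝕀 (hits (incidence S x) a i)
  ∣coverUnion∣≡∑hits {zero}  S a i = ∣[]∣ (coverUnion S a i)
  ∣coverUnion∣≡∑hits {suc m} S a i = begin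
    ∣ coverUnion S a i ∣          ≡⟨ cong ∣_∣ (coverUnion-∷ S a i) ⟩
    ∣ h ∷ coverUnion S′ a i ∣     ≡⟨ ∣x∷p∣ h (coverUnion S′ a i) ⟩
    𝕀 h + ∣ coverUnion S′ a i ∣   ≡⟨ cong (𝕀 h +_) (∣coverUnion∣≡∑hits S′ a i) ⟩
    ∑[ x < suc m ] 𝕀 (hits (incidence S x) a i) ∎
    where
    open ≡-Reasoning
    S′ = tail ∘ S
    h = hits (head ∘ S) a i

  coverage≡∑coveredCount : ∀ {m n k} (S : Fin n → Subset m) (a : Vec (Fin k) n) →
                           coverage S a ≡ ∑[ x < m ] coveredCount (incidence S x) a
  coverage≡∑coveredCount {m} {k = k} S a = begin
    coverage S a                          ≡⟨ sum-map-allFin (λ i → ∣ coverUnion S a i ∣) ⟩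
    ∑[ i < k ] ∣ coverUnion S a i ∣        ≡⟨ sum-cong-≗ {k} (∣coverUnion∣≡∑hits S a) ⟩
    ∑[ i < k ] ∑[ x < m ] hit i x         ≡⟨ ∑-comm hit ⟩
    ∑[ x < m ] coveredCount (incidence S x) a ∎
    where
    open ≡-Reasoning
    hit : Fin k → Fin m → ℕ
    hit i x = 𝕀 (hits (incidence S x) a i)

  coveredCount≤k : ∀ {n k} (b : Fin n → Bool) (a : Vec (Fin k) n) → coveredCount b a ≤ k
  coveredCount≤k {k = k} b a = begin
    ∑[ i < k ] 𝕀 (hits b a i) ≤⟨ ∑-mono-≤ (λ i → 𝕀≤1 (hits b a i)) ⟩
    ∑[ i < k ] 1              ≡⟨ ∑-const k 1 ⟩
    k * 1                     ≡⟨ *-identityʳ k ⟩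
    k                         ∎
    where open ≤-Reasoning

  coveredCount≤degree : ∀ {n k} (b : Fin n → Bool) (a : Vec (Fin k) n) → coveredCount b a ≤ degree b
  coveredCount≤degree {k = k} b []      = ≤-trans (≤-reflexive (sum-replicate-zero k)) z≤n
  coveredCount≤degree {k = k} b (x ∷ a) = begin
    ∑[ i < k ] 𝕀 ((b zero ∧ does (x ≟ i)) ∨ hits (b ∘ suc) a i)
      ≤⟨ ∑-mono-≤ (λ i → 𝕀-∨-≤ (b zero ∧ does (x ≟ i)) _) ⟩
    ∑[ i < k ] (𝕀 (b zero ∧ does (x ≟ i)) + 𝕀 (hits (b ∘ suc) a i))
      ≡⟨ ∑-distrib-+ (λ i → 𝕀 (b zero ∧ does (x ≟ i))) _ ⟩
    ∑[ i < k ] 𝕀 (b zero ∧ does (x ≟ i)) + coveredCount (b ∘ suc) a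
      ≤⟨ +-mono-≤ (≤-reflexive (chosen (b zero))) (coveredCount≤degree (b ∘ suc) a) ⟩
    degree b ∎
    where
    open ≤-Reasoning
    chosen : ∀ c → ∑[ i < k ] 𝕀 (c ∧ does (x ≟ i)) ≡ 𝕀 c
    chosen true  = ∑-𝕀-≟ʳ x
    chosen false = sum-replicate-zero k

  module _ {p : ℕ} where

    missed : ∀ {n} → (Fin n → Bool) → Fin (suc p) → ℕ
    missed {n} b i = assignmentSum n (suc p) (λ a → 𝕀 (not (hits b a i)))

    ∑-𝕀-not-∧-≟ : ∀ c (i : Fin (suc p)) →
                  ∑[ x < suc p ] 𝕀 (not (c ∧ does (x ≟ i))) ≡ (if c then p else suc p)
    ∑-𝕀-not-∧-≟ false i = trans (∑-const (suc p) 1) (*-identityʳ (suc p))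
    ∑-𝕀-not-∧-≟ true  i = +-cancelˡ-≡ 1 _ _ (begin
      1 + ∑[ x < suc p ] x≢i x                    ≡⟨ cong (_+ ∑[ x < suc p ] x≢i x) (∑-𝕀-≟ˡ i) ⟨
      ∑[ x < suc p ] x≡i x + ∑[ x < suc p ] x≢i x  ≡⟨ ∑-distrib-+ x≡i x≢i ⟨
      ∑[ x < suc p ] (x≡i x + x≢i x)              ≡⟨ sum-cong-≗ {suc p} (𝕀+𝕀-not ∘ x≟i) ⟩
      ∑[ x < suc p ] 1                            ≡⟨ ∑-const (suc p) 1 ⟩
      suc p * 1                                   ≡⟨ *-identityʳ (suc p) ⟩
      suc p                                       ∎)
      where
      open ≡-Reasoning
      x≟i : Fin (suc p) → Bool
      x≟i x = does (x ≟ i)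
      x≡i x≢i : Fin (suc p) → ℕ
      x≡i x = 𝕀 (x≟i x)
      x≢i x = 𝕀 (not (x≟i x))

    missed-∷ : ∀ {n} (b : Fin (suc n) → Bool) i →
               missed b i ≡ (if b zero then p else suc p) * missed (b ∘ suc) i
    missed-∷ {n} b i = begin
      missed b i
        ≡⟨ assignmentSum-∷ n (suc p) (λ a → 𝕀 (not (hits b a i))) ⟩
      ∑[ x < suc p ] assignmentSum n (suc p) (λ a → 𝕀 (not (first x ∨ hits (b ∘ suc) a i)))
        ≡⟨ sum-cong-≗ {suc p} factor ⟩
      ∑[ x < suc p ] (𝕀 (not (first x)) * missed (b ∘ suc) i)
        ≡⟨ *-distribʳ-sum (missed (b ∘ suc) i) (λ x → 𝕀 (not (first x))) ⟨
      ∑[ x < suc p ] 𝕀 (not (first x)) * missed (b ∘ suc) i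
        ≡⟨ cong (_* missed (b ∘ suc) i) (∑-𝕀-not-∧-≟ (b zero) i) ⟩
      (if b zero then p else suc p) * missed (b ∘ suc) i ∎
      where
      open ≡-Reasoning
      first : Fin (suc p) → Bool
      first x = b zero ∧ does (x ≟ i)
      factor : ∀ x → assignmentSum n (suc p) (λ a → 𝕀 (not (first x ∨ hits (b ∘ suc) a i)))
                     ≡ 𝕀 (not (first x)) * missed (b ∘ suc) i
      factor x = trans (sum-map-cong (λ a → 𝕀-not-∨ (first x) (hits (b ∘ suc) a i)) as)
                       (sum-map-*ˡ (𝕀 (not (first x))) (λ a → 𝕀 (not (hits (b ∘ suc) a i))) as)
        where as = allAssignments n (suc p)

    missed*k^D≡p^D*k^n : ∀ {n} (b : Fin n → Bool) i → missed b i * suc p ^ degree b ≡ p ^ degree b * suc p ^ n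
    missed*k^D≡p^D*k^n {zero}  b i = refl
    missed*k^D≡p^D*k^n {suc n} b i rewrite missed-∷ b i with b zero | missed*k^D≡p^D*k^n (b ∘ suc) i
    ... | true  | ih = begin
      p * M * (k * k ^ D)     ≡⟨ *-Comm.interchange p M k (k ^ D) ⟩
      p * k * (M * k ^ D)     ≡⟨ cong (p * k *_) ih ⟩
      p * k * (p ^ D * k ^ n) ≡⟨ *-Comm.interchange p k (p ^ D) (k ^ n) ⟩
      p * p ^ D * (k * k ^ n) ∎
      where
      open ≡-Reasoning
      k = suc p
      M = missed (b ∘ suc) i
      D = degree (b ∘ suc)
    ... | false | ih = begin
      k * M * k ^ D           ≡⟨ *-assoc k M (k ^ D) ⟩
      k * (M * k ^ D)         ≡⟨ cong (k *_) ih ⟩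
      k * (p ^ D * k ^ n)     ≡⟨ *-Comm.x∙yz≈y∙xz k (p ^ D) (k ^ n) ⟩
      p ^ D * (k * k ^ n)     ∎
      where
      open ≡-Reasoning
      k = suc p
      M = missed (b ∘ suc) i
      D = degree (b ∘ suc)

    covered+missed≡k^n*k : ∀ {n} (b : Fin n → Bool) →
                           assignmentSum n (suc p) (coveredCount b) + ∑[ i < suc p ] missed b i ≡ suc p ^ n * suc p
    covered+missed≡k^n*k {n} b = begin
      T + ∑[ i < k ] missed b i
        ≡⟨ cong (T +_) (sum-map-∑ (λ i a → 𝕀 (not (hits b a i))) as) ⟨
      T + assignmentSum n k (λ a → ∑[ i < k ] 𝕀 (not (hits b a i)))
        ≡⟨ sum-map-+ (coveredCount b) (λ a → ∑[ i < k ] 𝕀 (not (hits b a i))) as ⟨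
      assignmentSum n k (λ a → coveredCount b a + ∑[ i < k ] 𝕀 (not (hits b a i)))
        ≡⟨ sum-map-cong hit+miss as ⟩
      assignmentSum n k (λ _ → k)
        ≡⟨ assignmentSum-const n k k ⟩
      k ^ n * k ∎
      where
      open ≡-Reasoning
      k = suc p
      as = allAssignments n k
      T = assignmentSum n k (coveredCount b)
      hit+miss : ∀ a → coveredCount b a + ∑[ i < k ] 𝕀 (not (hits b a i)) ≡ k
      hit+miss a = begin
        ∑[ i < k ] hit i + ∑[ i < k ] miss i   ≡⟨ ∑-distrib-+ hit miss ⟨
        ∑[ i < k ] (hit i + miss i)            ≡⟨ sum-cong-≗ {k} (λ i → 𝕀+𝕀-not (hits b a i)) ⟩
        ∑[ i < k ] 1                           ≡⟨ ∑-const k 1 ⟩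
        k * 1                                  ≡⟨ *-identityʳ k ⟩
        k                                      ∎
        where
        hit miss : Fin k → ℕ
        hit i = 𝕀 (hits b a i)
        miss i = 𝕀 (not (hits b a i))

    -- On average an element of degree D lies in k·(1 − (p/k)^D) covers.
    expected-covered : ∀ {n} (b : Fin n → Bool) →
                       assignmentSum n (suc p) (coveredCount b) * suc p ^ degree b
                         ≡ suc p ^ n * suc p * gap p (degree b)
    expected-covered {n} b = +-cancelʳ-≡ (K * k * p ^ D) _ _ (begin
      T * k ^ D + K * k * p ^ D                       ≡⟨ cong (T * k ^ D +_) all-missed ⟨
      T * k ^ D + ∑[ i < k ] missed b i * k ^ D       ≡⟨ *-distribʳ-+ (k ^ D) T _ ⟨
      (T + ∑[ i < k ] missed b i) * k ^ D             ≡⟨ cong (_* k ^ D) (covered+missed≡k^n*k b) ⟩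
      K * k * k ^ D                                   ≡⟨ cong (K * k *_) (^≡^+gap p D) ⟩
      K * k * (p ^ D + gap p D)                       ≡⟨ *-distribˡ-+ (K * k) (p ^ D) (gap p D) ⟩
      K * k * p ^ D + K * k * gap p D                 ≡⟨ +-comm (K * k * p ^ D) _ ⟩
      K * k * gap p D + K * k * p ^ D                 ∎)
      where
      open ≡-Reasoning
      k = suc p
      K = k ^ n
      D = degree b
      T = assignmentSum n k (coveredCount b)
      all-missed : ∑[ i < k ] missed b i * k ^ D ≡ K * k * p ^ D
      all-missed = begin
        ∑[ i < k ] missed b i * k ^ D     ≡⟨ *-distribʳ-sum (k ^ D) (missed b) ⟩
        ∑[ i < k ] (missed b i * k ^ D)   ≡⟨ sum-cong-≗ {k} (missed*k^D≡p^D*k^n b) ⟩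
        ∑[ i < k ] (p ^ D * K)            ≡⟨ ∑-const k _ ⟩
        k * (p ^ D * K)                   ≡⟨ *-Comm.x∙yz≈zx∙y k (p ^ D) K ⟩
        K * k * p ^ D                     ∎

    element-bound : ∀ {n} (b : Fin n → Bool) →
                    (suc p ⊓ degree b) * (gap p (suc p) * suc p ^ n)
                      ≤ assignmentSum n (suc p) (coveredCount b) * suc p ^ suc p
    element-bound {n} b = *-cancelʳ-≤ _ _ (k ^ D) {{m^n≢0 k D}} (begin
      c * (gap p k * K) * k ^ D    ≡⟨ regroup c (gap p k) K (k ^ D) ⟩
      K * (c * k ^ D * gap p k)    ≤⟨ *-monoʳ-≤ K (⊓-gap p D) ⟩
      K * (k * Z * gap p D)        ≡⟨ regroup′ K k Z (gap p D) ⟩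
      K * k * gap p D * Z          ≡⟨ cong (_* Z) (expected-covered b) ⟨
      T * k ^ D * Z                ≡⟨ *-Comm.xy∙z≈xz∙y T (k ^ D) Z ⟩
      T * Z * k ^ D                ∎)
      where
      open ≤-Reasoning
      k = suc p
      K = k ^ n
      Z = k ^ k
      D = degree b
      c = k ⊓ D
      T = assignmentSum n k (coveredCount b)
      regroup : ∀ c g K d → c * (g * K) * d ≡ K * (c * d * g)
      regroup = solve-∀
      regroup′ : ∀ K k Z g → K * (k * Z * g) ≡ K * k * g * Z
      regroup′ = solve-∀

  coverageBound : ∀ {m n} → ℕ → (Fin n → Subset m) → ℕ
  coverageBound {m} k S = ∑[ x < m ] (k ⊓ degree (incidence S x))

  OPT≤coverageBound : ∀ {m n} k (S : Fin n → Subset m) → OPT k S ≤ coverageBound k S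
  OPT≤coverageBound {n = n} k S = foldr-⊔-lub (coverage S) (allAssignments n k) coverage≤bound
    where
    coverage≤bound : ∀ a → coverage S a ≤ coverageBound k S
    coverage≤bound a = ≤-trans (≤-reflexive (coverage≡∑coveredCount S a))
      (∑-mono-≤ (λ x → ⊓-glb (coveredCount≤k (incidence S x) a) (coveredCount≤degree (incidence S x) a)))

  OPT*gap*k^n≤total*k^k : ∀ {m n} p (S : Fin n → Subset m) →
    OPT (suc p) S * gap p (suc p) * suc p ^ n ≤ assignmentSum n (suc p) (coverage S) * suc p ^ suc p
  OPT*gap*k^n≤total*k^k {m} {n} p S = begin
    OPT k S * gap p k * k ^ n                ≡⟨ *-assoc (OPT k S) (gap p k) (k ^ n) ⟩
    OPT k S * X                              ≤⟨ *-monoˡ-≤ X (OPT≤coverageBound k S) ⟩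
    coverageBound k S * X                    ≡⟨ *-distribʳ-sum X c ⟩
    ∑[ x < m ] (c x * X)                     ≤⟨ ∑-mono-≤ (element-bound ∘ incidence S) ⟩
    ∑[ x < m ] (T x * k ^ k)                 ≡⟨ *-distribʳ-sum (k ^ k) T ⟨
    ∑[ x < m ] T x * k ^ k                   ≡⟨ cong (_* k ^ k) total ⟨
    assignmentSum n k (coverage S) * k ^ k   ∎
    where
    open ≤-Reasoning
    k = suc p
    X = gap p k * k ^ n
    c T : Fin m → ℕ
    c x = k ⊓ degree (incidence S x)
    T x = assignmentSum n k (coveredCount (incidence S x))
    total : assignmentSum n k (coverage S) ≡ ∑[ x < m ] T x
    total = trans (sum-map-cong (coverage≡∑coveredCount S) (allAssignments n k))
                  (sum-map-∑ (λ x → coveredCount (incidence S x)) (allAssignments n k))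

open Coverage

open import Data.Integer.Base using (+_)
import Data.Integer.Base as ℤ
import Data.Integer.Properties as ℤ
open import Data.Rational.Base using (ℚ; _+_; _-_; _*_; _/_; 0ℚ; 1ℚ; NonNegative; nonNegative; fromℚᵘ)
  renaming (_≤_ to _≤ℚ_)
import Data.Rational.Properties as ℚ
open import Data.Rational.Solver using (module +-*-Solver)
open import Data.Rational.Unnormalised.Base as ℚᵘ using (mkℚᵘ; *≡*; *≤*)
import Data.Rational.Unnormalised.Properties as ℚᵘ

fromℚᵘ-homo-+ : ∀ p q → fromℚᵘ (p ℚᵘ.+ q) ≡ fromℚᵘ p + fromℚᵘ q
fromℚᵘ-homo-+ p q = ℚ.toℚᵘ-injective (ℚᵘ.≃-trans (ℚ.toℚᵘ-fromℚᵘ (p ℚᵘ.+ q)) (ℚᵘ.≃-sym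
  (ℚᵘ.≃-trans (ℚ.toℚᵘ-homo-+ (fromℚᵘ p) (fromℚᵘ q))
              (ℚᵘ.+-cong (ℚ.toℚᵘ-fromℚᵘ p) (ℚ.toℚᵘ-fromℚᵘ q)))))

fromℚᵘ-homo-* : ∀ p q → fromℚᵘ (p ℚᵘ.* q) ≡ fromℚᵘ p * fromℚᵘ q
fromℚᵘ-homo-* p q = ℚ.toℚᵘ-injective (ℚᵘ.≃-trans (ℚ.toℚᵘ-fromℚᵘ (p ℚᵘ.* q)) (ℚᵘ.≃-sym
  (ℚᵘ.≃-trans (ℚ.toℚᵘ-homo-* (fromℚᵘ p) (fromℚᵘ q))
              (ℚᵘ.*-cong (ℚ.toℚᵘ-fromℚᵘ p) (ℚ.toℚᵘ-fromℚᵘ q)))))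

fromℚᵘ-mono-≤ : ∀ {p q} → p ℚᵘ.≤ q → fromℚᵘ p ≤ℚ fromℚᵘ q
fromℚᵘ-mono-≤ {p} {q} p≤q = ℚ.toℚᵘ-cancel-≤
  (ℚᵘ.≤-respˡ-≃ (ℚᵘ.≃-sym (ℚ.toℚᵘ-fromℚᵘ p))
                (ℚᵘ.≤-respʳ-≃ (ℚᵘ.≃-sym (ℚ.toℚᵘ-fromℚᵘ q)) p≤q))

-- a /ℕ suc b is definitionally fromℚᵘ (mkℚᵘ (+ a) b), so the /ℕ lemmas reduce to cross-multiplication.
/ℕ-cong : ∀ {a b c d} .{{_ : NonZero b}} .{{_ : NonZero d}} → a ℕ.* d ≡ c ℕ.* b → a /ℕ b ≡ c /ℕ d
/ℕ-cong {a} {suc b} {c} {suc d} ad≡cb = ℚ.fromℚᵘ-cong {mkℚᵘ (+ a) b} {mkℚᵘ (+ c) d}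
  (*≡* (trans (sym (ℤ.pos-* a (suc d))) (trans (cong +_ ad≡cb) (ℤ.pos-* c (suc b)))))

/ℕ-mono-≤ : ∀ {a b c d} .{{_ : NonZero b}} .{{_ : NonZero d}} → a ℕ.* d ≤ c ℕ.* b → a /ℕ b ≤ℚ c /ℕ d
/ℕ-mono-≤ {a} {suc b} {c} {suc d} ad≤cb = fromℚᵘ-mono-≤ {mkℚᵘ (+ a) b} {mkℚᵘ (+ c) d}
  (*≤* (subst₂ ℤ._≤_ (ℤ.pos-* a (suc d)) (ℤ.pos-* c (suc b)) (ℤ.+≤+ ad≤cb)))

/ℕ≡1 : ∀ {a b} .{{_ : NonZero b}} → a ≡ b → a /ℕ b ≡ 1ℚ
/ℕ≡1 {a} {b} a≡b = /ℕ-cong {a} {b} {1} {1} (trans (*-identityʳ a) (trans a≡b (sym (*-identityˡ b))))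

/ℕ≤1 : ∀ {a b} .{{_ : NonZero b}} → a ≤ b → a /ℕ b ≤ℚ 1ℚ
/ℕ≤1 {a} {b} a≤b = /ℕ-mono-≤ {a} {b} {1} {1} (subst₂ _≤_ (sym (*-identityʳ a)) (sym (*-identityˡ b)) a≤b)

/ℕ-nonNeg : ∀ a b .{{_ : NonZero b}} → NonNegative (a /ℕ b)
/ℕ-nonNeg a b = nonNegative (/ℕ-mono-≤ {0} {1} {a} {b} z≤n)

/ℕ-* : ∀ a b c d .{{_ : NonZero b}} .{{_ : NonZero d}} → a /ℕ b * c /ℕ d ≡ (a ℕ.* c) /ℕ (b ℕ.* d)
/ℕ-* a (suc b) c (suc d) = trans (sym (fromℚᵘ-homo-* (mkℚᵘ (+ a) b) (mkℚᵘ (+ c) d)))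
  (cong (λ z → fromℚᵘ (mkℚᵘ z _)) (sym (ℤ.pos-* a c)))

/ℕ-+ : ∀ a b c d .{{_ : NonZero b}} .{{_ : NonZero d}} →
       a /ℕ b + c /ℕ d ≡ (a ℕ.* d ℕ.+ c ℕ.* b) /ℕ (b ℕ.* d)
/ℕ-+ a (suc b) c (suc d) = trans (sym (fromℚᵘ-homo-+ (mkℚᵘ (+ a) b) (mkℚᵘ (+ c) d)))
  (cong (λ z → fromℚᵘ (mkℚᵘ z _))
        (trans (cong₂ ℤ._+_ (sym (ℤ.pos-* a (suc d))) (sym (ℤ.pos-* c (suc b))))
               (sym (ℤ.pos-+ (a ℕ.* suc d) _))))

foldr-+ : ∀ {A : Set} (f : A → ℚ) v xs →
          foldr (λ x acc → f x + acc) v xs ≡ foldr (λ x acc → f x + acc) 0ℚ xs + v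
foldr-+ f v []       = sym (ℚ.+-identityˡ v)
foldr-+ f v (x ∷ xs) = trans (cong (λ t → f x + t) (foldr-+ f v xs)) (sym (ℚ.+-assoc (f x) _ v))

eApprox-suc : ∀ N → eApprox (suc N) ≡ eApprox N + 1 /ℕ (suc N !)
eApprox-suc N = begin
  foldr f 0ℚ (upTo (suc (suc N)))              ≡⟨ cong (foldr f 0ℚ) (upTo-∷ʳ (suc N)) ⟨
  foldr f 0ℚ (upTo (suc N) ∷ʳ suc N)           ≡⟨ foldr-∷ʳ f 0ℚ (suc N) (upTo (suc N)) ⟩
  foldr f (1 /ℕ (suc N !) + 0ℚ) (upTo (suc N)) ≡⟨ foldr-+ (λ j → 1 /ℕ (j !)) _ (upTo (suc N)) ⟩
  eApprox N + (1 /ℕ (suc N !) + 0ℚ)            ≡⟨ cong (λ t → eApprox N + t) (ℚ.+-identityʳ _) ⟩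
  eApprox N + 1 /ℕ (suc N !)                   ∎
  where
  open ≡-Reasoning
  f : ℕ → ℚ → ℚ
  f j acc = 1 /ℕ (j !) + acc

eApprox≡eNumerator/N! : ∀ N → eApprox N ≡ eNumerator N /ℕ (N !)
eApprox≡eNumerator/N! zero    = ℚ.+-identityʳ (1 /ℕ 1)
eApprox≡eNumerator/N! (suc N) = begin
  eApprox (suc N)
    ≡⟨ eApprox-suc N ⟩
  eApprox N + 1 /ℕ (suc N !)
    ≡⟨ cong (_+ 1 /ℕ (suc N !)) (eApprox≡eNumerator/N! N) ⟩
  eNumerator N /ℕ (N !) + 1 /ℕ (suc N !)
    ≡⟨ /ℕ-+ (eNumerator N) (N !) 1 (suc N !) ⟩
  (eNumerator N ℕ.* suc N ! ℕ.+ 1 ℕ.* N !) /ℕ (N ! ℕ.* suc N !)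
    ≡⟨ /ℕ-cong (cross (suc N) (eNumerator N) (N !)) ⟩
  eNumerator (suc N) /ℕ (suc N !)
    ∎
  where
  open ≡-Reasoning
  instance
    N!≢0 = N !≢0
    [1+N]!≢0 = suc N !≢0
    N!*[1+N]!≢0 = N !* suc N !≢0
  cross : ∀ n w f → (w ℕ.* (n ℕ.* f) ℕ.+ 1 ℕ.* f) ℕ.* (n ℕ.* f)
                   ≡ (n ℕ.* w ℕ.+ 1) ℕ.* (f ℕ.* (n ℕ.* f))
  cross = solve-∀

loss-bound : ∀ {o E e δ y} → NonNegative o → NonNegative e →
             o * δ ≤ℚ E → δ + y ≡ 1ℚ → y * e ≤ℚ 1ℚ → (o - E) * e ≤ℚ o
loss-bound {o} {E} {e} {δ} {y} o≥0 e≥0 oδ≤E δ+y≡1 ye≤1 = begin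
  (o - E) * e    ≤⟨ ℚ.*-monoʳ-≤-nonNeg e {{e≥0}} o-E≤oy ⟩
  o * y * e      ≡⟨ ℚ.*-assoc o y e ⟩
  o * (y * e)    ≤⟨ ℚ.*-monoˡ-≤-nonNeg o {{o≥0}} ye≤1 ⟩
  o * 1ℚ         ≡⟨ ℚ.*-identityʳ o ⟩
  o              ∎
  where
  open ℚ.≤-Reasoning
  o-E≤oy : o - E ≤ℚ o * y
  o-E≤oy = begin
    o - E                ≤⟨ ℚ.+-monoʳ-≤ o (ℚ.neg-antimono-≤ oδ≤E) ⟩
    o - o * δ            ≡⟨ cong (λ t → t - o * δ) o≡o[δ+y] ⟩
    o * (δ + y) - o * δ  ≡⟨ +-*-Solver.solve 3 (λ o δ y → o :* (δ :+ y) :- o :* δ := o :* y) refl o δ y ⟩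
    o * y                ∎
    where
    open +-*-Solver
    o≡o[δ+y] : o ≡ o * (δ + y)
    o≡o[δ+y] = trans (sym (ℚ.*-identityʳ o)) (cong (o *_) (sym δ+y≡1))

OPT*gap/k^k≤expectedCoverage : ∀ {m n} p (S : Fin n → Subset m) →
  (+ OPT (suc p) S) / 1 * (gap p (suc p) /ℕ (suc p ^ suc p)) ≤ℚ expectedCoverage (suc p) S
OPT*gap/k^k≤expectedCoverage {n = n} p S = begin
  OPT k S /ℕ 1 * gap p k /ℕ (k ^ k)              ≡⟨ /ℕ-* (OPT k S) 1 (gap p k) (k ^ k) ⟩
  (OPT k S ℕ.* gap p k) /ℕ (1 ℕ.* k ^ k)         ≡⟨ cong ((OPT k S ℕ.* gap p k) /ℕ_) (*-identityˡ (k ^ k)) ⟩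
  (OPT k S ℕ.* gap p k) /ℕ (k ^ k)               ≤⟨ /ℕ-mono-≤ (OPT*gap*k^n≤total*k^k p S) ⟩
  assignmentSum n k (coverage S) /ℕ (k ^ n)      ∎
  where
  open ℚ.≤-Reasoning
  k = suc p
  instance
    k^k≢0 = m^n≢0 k k
    k^n≢0 = m^n≢0 k n

gap/k^k+p^k/k^k≡1 : ∀ p → gap p (suc p) /ℕ (suc p ^ suc p) + (p ^ suc p) /ℕ (suc p ^ suc p) ≡ 1ℚ
gap/k^k+p^k/k^k≡1 p = trans (/ℕ-+ (gap p k) (k ^ k) (p ^ k) (k ^ k)) (/ℕ≡1 (begin
  gap p k ℕ.* k ^ k ℕ.+ p ^ k ℕ.* k ^ k    ≡⟨ *-distribʳ-+ (k ^ k) (gap p k) (p ^ k) ⟨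
  (gap p k ℕ.+ p ^ k) ℕ.* k ^ k            ≡⟨ cong (ℕ._* k ^ k) gap+p^k≡k^k ⟩
  k ^ k ℕ.* k ^ k                          ∎))
  where
  open ≡-Reasoning
  k = suc p
  gap+p^k≡k^k : gap p k ℕ.+ p ^ k ≡ k ^ k
  gap+p^k≡k^k = trans (+-comm (gap p k) (p ^ k)) (sym (^≡^+gap p k))
  instance
    k^k≢0 = m^n≢0 k k
    k^k*k^k≢0 = m*n≢0 (k ^ k) (k ^ k)

p^k/k^k*eApprox≤1 : ∀ p N → (p ^ suc p) /ℕ (suc p ^ suc p) * eApprox N ≤ℚ 1ℚ
p^k/k^k*eApprox≤1 p N = begin
  (p ^ k) /ℕ (k ^ k) * eApprox N                 ≡⟨ cong ((p ^ k) /ℕ (k ^ k) *_) (eApprox≡eNumerator/N! N) ⟩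
  (p ^ k) /ℕ (k ^ k) * eNumerator N /ℕ (N !)     ≡⟨ /ℕ-* (p ^ k) (k ^ k) (eNumerator N) (N !) ⟩
  (p ^ k ℕ.* eNumerator N) /ℕ (k ^ k ℕ.* N !)    ≤⟨ /ℕ≤1 (eNumerator-bound p N) ⟩
  1ℚ                                             ∎
  where
  open ℚ.≤-Reasoning
  k = suc p
  instance
    k^k≢0 = m^n≢0 k k
    N!≢0 = N !≢0
    k^k*N!≢0 = m*n≢0 (k ^ k) (N !)

-- The hypothesis 2 ≤ k is used only through k ≠ 0.
theorem1 : (m n k : ℕ) → 2 ≤ k → (S : Fin n → Subset m) →
    (N : ℕ) →
      ((+ OPT k S) / 1 - expectedCoverage k S) * eApprox N ≤ℚ (+ OPT k S) / 1
theorem1 m n (suc p) _ S N =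
  loss-bound (/ℕ-nonNeg (OPT (suc p) S) 1) e≥0
             (OPT*gap/k^k≤expectedCoverage p S) (gap/k^k+p^k/k^k≡1 p) (p^k/k^k*eApprox≤1 p N)
  where
  e≥0 : NonNegative (eApprox N)
  e≥0 = subst NonNegative (sym (eApprox≡eNumerator/N! N)) (/ℕ-nonNeg (eNumerator N) (N !) {{N !≢0}})
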